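{- For every finite simple graph $G(V,E)$, the set of all words over the alphabet $V$ that are $1$-$11$-representations of $G$ is a regular language over $V$.
   Context: For a word $w$ and letters $x,y$, $w_{\{x,y\}}$ denotes the word obtained from $w$ by deleting all letters other than $x$ and $y$. A word $w\in V^{+}$ is a $1$-$11$-representation of a graph $G(V,E)$ if for all distinct $x,y\in V$: $x,y$ are adjacent in $G$ iff $w_{\{x,y\}}$ contains at most one factor of the form $xx$ or $yy$ in total (equivalently, non-adjacent iff $w_{\{x,y\}}$ contains at least two occurrences of $xx$, or at least two of $yy$, or at least one of each). -}

module Defs where

open import Data.Nat using (ℕ; zero; suc; _+_; _≤_)
open import Data.Fin using (Fin; _≟_)
open import Data.Bool using (Bool; true; false; _∧_; _∨_; if_then_else_)
open import Data.List using (List; []; _∷_; filter)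
open import Data.Product using (Σ; _×_)
open import Relation.Nullary using (¬_; does)
open import Relation.Nullary.Decidable using (_⊎-dec_)
open import Relation.Binary.PropositionalEquality using (_≡_; _≢_)
open import Function.Bundles using (_⇔_)

record SimpleGraph (n : ℕ) : Set where
  field
    adj     : Fin n → Fin n → Bool
    adj-sym : ∀ x y → adj x y ≡ adj y x
    irrefl  : ∀ x → adj x x ≡ false

open SimpleGraph public

Word : Set → Set
Word A = List A

restrict : ∀ {n} → Fin n → Fin n → Word (Fin n) → Word (Fin n)
restrict x y w = filter (λ z → (z ≟ x) ⊎-dec (z ≟ y)) w

-- number of factors (consecutive positions, occurrences counted with overlap) of the form xx in u
countSq : ∀ {n} → Fin n → Word (Fin n) → ℕ
countSq x [] = 0
countSq x (a ∷ []) = 0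
countSq x (a ∷ b ∷ u) =
  (if does (a ≟ x) ∧ does (b ≟ x) then 1 else 0) + countSq x (b ∷ u)

NonEmptyWord : ∀ {A : Set} → Word A → Set
NonEmptyWord w = w ≢ []

Is1-11-Rep : ∀ {n} → SimpleGraph n → Word (Fin n) → Set
Is1-11-Rep {n} G w =
  NonEmptyWord w ×
  (∀ (x y : Fin n) → x ≢ y →
     (adj G x y ≡ true ⇔
       (countSq x (restrict x y w) + countSq y (restrict x y w) ≤ 1)))

record DFA (A : Set) : Set where
  field
    k      : ℕ
    δ      : Fin k → A → Fin k
    start  : Fin k
    accept : Fin k → Bool

run : ∀ {A} (D : DFA A) → Fin (DFA.k D) → Word A → Fin (DFA.k D)
run D q [] = q
run D q (a ∷ w) = run D (DFA.δ D q a) w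

Accepts : ∀ {A} → DFA A → Word A → Set
Accepts D w = DFA.accept D (run D (DFA.start D) w) ≡ true

IsRegular : ∀ {A : Set} → (Word A → Set) → Set
IsRegular {A} L = Σ (DFA A) λ D → ∀ w → Accepts D w ⇔ L w

-- The 1-11 condition is a finite conjunction (non-emptiness and one condition per
-- pair x ≠ y), and regular languages are closed under finite intersections.  The
-- condition for x, y is decided by an automaton that remembers only the last letter
-- of w_{x,y} read so far and the number of squares in w_{x,y} saturated at 2, since
-- the condition only distinguishes counts ≤ 1 from counts ≥ 2.
module Submission where

open import Defs
open import Data.Nat using (ℕ; zero; suc; _+_; _*_; _≤_; _≤?_; z≤n; s≤s; s≤s⁻¹)
open import Data.Nat.Properties using (+-assoc; +-identityʳ; +-commutativeSemigroup)
open import Algebra.Properties.CommutativeSemigroup +-commutativeSemigroup using (interchange)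
open import Data.Fin using (Fin; zero; suc; toℕ; _≟_)
open import Data.Fin.Properties using (*↔×; 2↔Bool; ∀-cons-⇔)
open import Data.Bool using (true; false; not; _∧_; if_then_else_)
open import Data.Bool.Properties using () renaming (_≟_ to _≟ᵇ_)
open import Data.Maybe using (Maybe; just; nothing; maybe)
open import Data.List using (List; []; _∷_; _++_; [_]; filter; last; null)
open import Data.List.Properties using (++-assoc; ++-identityʳ; filter-++)
open import Data.Product using (_×_; _,_)
open import Data.Product.Function.NonDependent.Propositional using (_×-⇔_; _×-↔_)
open import Data.Sum using (_⊎_)
open import Function using (_∘_; id)
open import Function.Bundles using (_⇔_; _↔_; mk⇔; mk↔ₛ′; Equivalence; Inverse)
open import Function.Construct.Composition using (_⇔-∘_; _↔-∘_)
open import Function.Construct.Symmetry using (⇔-sym)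
open import Function.Construct.Identity using (↔-id)
open import Relation.Nullary using (Dec; does; ¬?; _×-dec_; _→-dec_; contradiction)
open import Relation.Nullary.Decidable using (yes; no; map′; _⊎-dec_)
open import Relation.Unary using (Decidable)
open import Relation.Binary.PropositionalEquality
  using (_≡_; _≢_; refl; sym; trans; cong; cong₂; subst; module ≡-Reasoning)

does≡true⇔ : ∀ {P : Set} (P? : Dec P) → does P? ≡ true ⇔ P
does≡true⇔ (yes p) = mk⇔ (λ _ → p) (λ _ → refl)
does≡true⇔ (no ¬p) = mk⇔ (λ ()) (λ p → contradiction p ¬p)

_⇔-dec_ : ∀ {P Q : Set} → Dec P → Dec Q → Dec (P ⇔ Q)
P? ⇔-dec Q? = map′ (λ (f , g) → mk⇔ f g) (λ e → Equivalence.to e , Equivalence.from e)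
                   ((P? →-dec Q?) ×-dec (Q? →-dec P?))

Fin-suc↔Maybe : ∀ {n} → Fin (suc n) ↔ Maybe (Fin n)
Fin-suc↔Maybe = mk↔ₛ′ (λ { zero → nothing ; (suc i) → just i }) (maybe suc zero)
                      (λ { nothing → refl ; (just i) → refl })
                      (λ { zero → refl ; (suc i) → refl })

last-snoc : ∀ {A : Set} (u : List A) a → last (u ++ [ a ]) ≡ just a
last-snoc []          a = refl
last-snoc (b ∷ [])    a = refl
last-snoc (b ∷ c ∷ u) a = last-snoc (c ∷ u) a

module _ {A : Set} where

  IsRegular-resp-⇔ : {L M : Word A → Set} → (∀ w → L w ⇔ M w) → IsRegular L → IsRegular M
  IsRegular-resp-⇔ L⇔M (D , acc) = D , λ w → L⇔M w ⇔-∘ acc w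

  run-snoc : ∀ (D : DFA A) q v a → run D q (v ++ [ a ]) ≡ DFA.δ D (run D q v) a
  run-snoc D q []      a = refl
  run-snoc D q (b ∷ v) a = run-snoc D (DFA.δ D q b) v a

  regular-bySummary : ∀ {S : Set} {k} → Fin k ↔ S →
    (step : S → A → S) (f : Word A → S) → (∀ v a → f (v ++ [ a ]) ≡ step (f v) a) →
    {P : S → Set} → Decidable P →
    {L : Word A → Set} → (∀ w → P (f w) ⇔ L w) → IsRegular L
  regular-bySummary {k = k} enum step f f-snoc {P} P? {L} P⇔L = D , accepts
    where
    open Inverse enum using (to; from; strictlyInverseˡ)

    D : DFA A
    D = record { k = k ; δ = λ q a → from (step (to q) a) ; start = from (f [])
               ; accept = λ q → does (P? (to q)) }

    run-from : ∀ v w → run D (from (f v)) w ≡ from (f (v ++ w))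
    run-from v []      = cong (from ∘ f) (sym (++-identityʳ v))
    run-from v (a ∷ w) = begin
      run D (from (step (to (from (f v))) a)) w  ≡⟨ cong (λ s → run D (from (step s a)) w) (strictlyInverseˡ (f v)) ⟩
      run D (from (step (f v) a)) w              ≡⟨ cong (λ s → run D (from s) w) (f-snoc v a) ⟨
      run D (from (f (v ++ [ a ]))) w            ≡⟨ run-from (v ++ [ a ]) w ⟩
      from (f ((v ++ [ a ]) ++ w))               ≡⟨ cong (from ∘ f) (++-assoc v [ a ] w) ⟩
      from (f (v ++ a ∷ w))                      ∎
      where open ≡-Reasoning

    reaches : ∀ w → to (run D (from (f [])) w) ≡ f w
    reaches w = trans (cong to (run-from [] w)) (strictlyInverseˡ (f w))

    accepts : ∀ w → Accepts D w ⇔ L w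
    accepts w = subst (λ s → does (P? s) ≡ true ⇔ L w) (sym (reaches w))
                      (P⇔L w ⇔-∘ does≡true⇔ (P? (f w)))

  ∩-regular : {L M : Word A → Set} → IsRegular L → IsRegular M → IsRegular (λ w → L w × M w)
  ∩-regular (D₁ , acc₁) (D₂ , acc₂) =
    regular-bySummary *↔×
      (λ (p , q) a → DFA.δ D₁ p a , DFA.δ D₂ q a)
      (λ w → run D₁ (DFA.start D₁) w , run D₂ (DFA.start D₂) w)
      (λ v a → cong₂ _,_ (run-snoc D₁ _ v a) (run-snoc D₂ _ v a))
      (λ (p , q) → (DFA.accept D₁ p ≟ᵇ true) ×-dec (DFA.accept D₂ q ≟ᵇ true))
      (λ w → acc₁ w ×-⇔ acc₂ w)

  ⋂-regular : ∀ {m} {L : Fin m → Word A → Set} →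
    (∀ i → IsRegular (L i)) → IsRegular (λ w → ∀ i → L i w)
  ⋂-regular {zero} _ =
    record { k = 1 ; δ = λ _ _ → zero ; start = zero ; accept = λ _ → true } ,
    λ _ → mk⇔ (λ _ ()) (λ _ → refl)
  ⋂-regular {suc m} regular =
    IsRegular-resp-⇔ (λ _ → ∀-cons-⇔) (∩-regular (regular zero) (⋂-regular (regular ∘ suc)))

  nonEmpty-regular : IsRegular (NonEmptyWord {A})
  nonEmpty-regular =
    regular-bySummary 2↔Bool (λ _ _ → true) (not ∘ null) nonEmpty-snoc (_≟ᵇ true) nonEmpty⇔
    where
    nonEmpty-snoc : ∀ v a → not (null (v ++ [ a ])) ≡ true
    nonEmpty-snoc []      a = refl
    nonEmpty-snoc (_ ∷ _) a = refl

    nonEmpty⇔ : ∀ w → not (null w) ≡ true ⇔ NonEmptyWord w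
    nonEmpty⇔ []      = mk⇔ (λ ()) (λ w≢[] → contradiction refl w≢[])
    nonEmpty⇔ (_ ∷ _) = mk⇔ (λ _ ()) (λ _ → refl)

saturate : ∀ b → ℕ → Fin (suc b)
saturate zero    _       = zero
saturate (suc b) zero    = zero
saturate (suc b) (suc m) = suc (saturate b m)

saturate-+ : ∀ b m k → saturate b (m + k) ≡ saturate b (toℕ (saturate b m) + k)
saturate-+ zero    m       k = refl
saturate-+ (suc b) zero    k = refl
saturate-+ (suc b) (suc m) k = cong suc (saturate-+ b m k)

toℕ-saturate-≤ : ∀ b m → toℕ (saturate (suc b) m) ≤ b ⇔ m ≤ b
toℕ-saturate-≤ zero    zero    = mk⇔ id id
toℕ-saturate-≤ zero    (suc m) = mk⇔ (λ ()) (λ ())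
toℕ-saturate-≤ (suc b) zero    = mk⇔ (λ _ → z≤n) (λ _ → z≤n)
toℕ-saturate-≤ (suc b) (suc m) = mk⇔ (s≤s ∘ to ∘ s≤s⁻¹) (s≤s ∘ from ∘ s≤s⁻¹)
  where open Equivalence (toℕ-saturate-≤ b m)

module _ {n : ℕ} where

  isSquare : Fin n → Fin n → Fin n → ℕ
  isSquare z a b = if does (a ≟ z) ∧ does (b ≟ z) then 1 else 0

  squareAfter : Fin n → Maybe (Fin n) → Fin n → ℕ
  squareAfter z nothing  a = 0
  squareAfter z (just b) a = isSquare z b a

  countSq-snoc : ∀ z (u : Word (Fin n)) a →
    countSq z (u ++ [ a ]) ≡ countSq z u + squareAfter z (last u) a
  countSq-snoc z []          a = refl
  countSq-snoc z (b ∷ [])    a = +-identityʳ (isSquare z b a)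
  countSq-snoc z (b ∷ c ∷ u) a =
    trans (cong (isSquare z b c +_) (countSq-snoc z (c ∷ u) a))
          (sym (+-assoc (isSquare z b c) (countSq z (c ∷ u)) _))

module PairCondition {n : ℕ} (G : SimpleGraph n) (x y : Fin n) where

  squareCount : Word (Fin n) → ℕ
  squareCount u = countSq x u + countSq y u

  Condition : Word (Fin n) → Set
  Condition w = x ≢ y → (adj G x y ≡ true ⇔ squareCount (restrict x y w) ≤ 1)

  newSquares : Maybe (Fin n) → Fin n → ℕ
  newSquares m a = squareAfter x m a + squareAfter y m a

  squareCount-snoc : ∀ u a → squareCount (u ++ [ a ]) ≡ squareCount u + newSquares (last u) a
  squareCount-snoc u a = begin
    countSq x (u ++ [ a ]) + countSq y (u ++ [ a ])
      ≡⟨ cong₂ _+_ (countSq-snoc x u a) (countSq-snoc y u a) ⟩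
    (countSq x u + squareAfter x (last u) a) + (countSq y u + squareAfter y (last u) a)
      ≡⟨ interchange (countSq x u) _ (countSq y u) _ ⟩
    squareCount u + newSquares (last u) a
      ∎
    where open ≡-Reasoning

  isXY : Decidable (λ z → z ≡ x ⊎ z ≡ y)
  isXY z = (z ≟ x) ⊎-dec (z ≟ y)

  Summary : Set
  Summary = Maybe (Fin n) × Fin 3

  Summary-enumeration : Fin (suc n * 3) ↔ Summary
  Summary-enumeration = (Fin-suc↔Maybe ×-↔ ↔-id (Fin 3)) ↔-∘ *↔×

  summarise : Word (Fin n) → Summary
  summarise u = last u , saturate 2 (squareCount u)

  summary : Word (Fin n) → Summary
  summary w = summarise (restrict x y w)

  summaryStep : Summary → Fin n → Summary
  summaryStep (m , c) a =
    if does (isXY a) then (just a , saturate 2 (toℕ c + newSquares m a)) else (m , c)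

  summarise-snoc : ∀ u a →
    summarise (u ++ [ a ]) ≡ (just a , saturate 2 (toℕ (saturate 2 (squareCount u)) + newSquares (last u) a))
  summarise-snoc u a = cong₂ _,_ (last-snoc u a)
    (trans (cong (saturate 2) (squareCount-snoc u a)) (saturate-+ 2 (squareCount u) _))

  summarise-++-filter : ∀ u a → summarise (u ++ filter isXY [ a ]) ≡ summaryStep (summarise u) a
  summarise-++-filter u a with does (isXY a)
  ... | true  = summarise-snoc u a
  ... | false = cong summarise (++-identityʳ u)

  summary-snoc : ∀ v a → summary (v ++ [ a ]) ≡ summaryStep (summary v) a
  summary-snoc v a = trans (cong summarise (filter-++ isXY v [ a ]))
                           (summarise-++-filter (restrict x y v) a)

  Accepting : Summary → Set
  Accepting (_ , c) = x ≢ y → (adj G x y ≡ true ⇔ toℕ c ≤ 1)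

  accepting? : Decidable Accepting
  accepting? (_ , c) = ¬? (x ≟ y) →-dec ((adj G x y ≟ᵇ true) ⇔-dec (toℕ c ≤? 1))

  Accepting⇔Condition : ∀ w → Accepting (summary w) ⇔ Condition w
  Accepting⇔Condition w = mk⇔ (λ h x≢y → saturated ⇔-∘ h x≢y) (λ h x≢y → ⇔-sym saturated ⇔-∘ h x≢y)
    where saturated = toℕ-saturate-≤ 1 (squareCount (restrict x y w))

  regular : IsRegular Condition
  regular = regular-bySummary Summary-enumeration summaryStep summary summary-snoc
                              accepting? Accepting⇔Condition

mainTheorem8 : ∀ (n : ℕ) (G : SimpleGraph n) → IsRegular (Is1-11-Rep G)
mainTheorem8 n G =
  ∩-regular nonEmpty-regular (⋂-regular λ x → ⋂-regular λ y → PairCondition.regular G x y)
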